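{- Let $G=(S,T;E)$ with $S=\{s_1,\dots,s_n\}$, $w:E\to\mathbb R_+$ and $d\in\mathbb Z_+$. Choose $k\in\{d-1,\dots,3d-3\}$ such that $2d-1$ divides $n+k$, add $k$ new isolated nodes $s_{n+1},\dots,s_{n+k}$ to $S$, and regard $s_1,\dots,s_{n+k}$ in cyclic order (indices taken modulo $n+k$). For each $j$ let $H_j$ be the subgraph induced by $\{s_j,s_{j+1},\dots,s_{j+d-1}\}\cup T$ (cyclic indices) and let $F_j$ be a maximum-weight matching of $H_j$ with respect to $w$. For $i=1,\dots,2d-1$ let $M_i=\bigcup_{j=0}^{\frac{n+k}{2d-1}-1}F_{i+j(2d-1)}$, and let $i^*\in\arg\max\{w(M_i): i=1,\dots,2d-1\}$. Then $M_{i^*}$ is a $d$-distance matching of $G$ and $w(M^*)\le\left(2-\frac1d\right)w(M_{i^*})$ for every $d$-distance matching $M^*$ of $G$.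
   Context: $G$ is a finite bipartite graph without loops or parallel edges; the nodes of $S$ are in the fixed order $s_1,\dots,s_n$. A $d$-distance matching is a subset $M\subseteq E$ such that every node of $S$ is incident to at most one edge of $M$, and whenever $s_it,s_jt\in M$ with $i\ne j$, $t\in T$, we have $|j-i|\ge d$; $w(M)=\sum_{e\in M}w(e)$.
   Formalization: The edge weights take values in the nonnegative rationals instead of the nonnegative reals. -}

module Defs where

open import Data.Nat as ℕ using (ℕ; zero; suc; _+_; _*_; _∸_; _<_; _≤_; ∣_-_∣)
open import Data.Fin using (Fin; toℕ; splitAt; _↑ˡ_)
open import Data.Bool using (Bool; true; false; if_then_else_; _∨_)
open import Data.Sum using (_⊎_; [_,_]′)
open import Data.Product using (Σ; _×_; ∃)
open import Data.Rational as ℚ using (ℚ; 0ℚ)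
open import Relation.Binary.PropositionalEquality using (_≡_; _≢_)
open import Relation.Nullary using (¬_)

-- A bipartite graph G = (S, T; E) with S = {s_0,…,s_{n-1}} (0-based, in this
-- order) and T = Fin m.  No parallel edges: E is given by an adjacency
-- relation  adj s t ≡ true.
Adj : ℕ → ℕ → Set
Adj n m = Fin n → Fin m → Bool

EdgeSet : ℕ → ℕ → Set
EdgeSet n m = Fin n → Fin m → Bool

-- Weights (values on non-edges are irrelevant).
Weight : ℕ → ℕ → Set
Weight n m = Fin n → Fin m → ℚ

sumFin : (n : ℕ) → (Fin n → ℚ) → ℚ
sumFin zero    f = 0ℚ
sumFin (suc n) f = f Fin.zero ℚ.+ sumFin n (λ i → f (Fin.suc i))
  where import Data.Fin as Fin

wt : {n m : ℕ} → Weight n m → EdgeSet n m → ℚ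
wt {n} {m} w M = sumFin n (λ s → sumFin m (λ t → if M s t then w s t else 0ℚ))

anyBelow : ℕ → (ℕ → Bool) → Bool
anyBelow zero    f = false
anyBelow (suc q) f = anyBelow q f ∨ f q

SubsetOfEdges : {n m : ℕ} → Adj n m → EdgeSet n m → Set
SubsetOfEdges adj M = ∀ s t → M s t ≡ true → adj s t ≡ true

IsDDistanceMatching : {n m : ℕ} → ℕ → Adj n m → EdgeSet n m → Set
IsDDistanceMatching d adj M =
  SubsetOfEdges adj M
  × (∀ s t t′ → M s t ≡ true → M s t′ ≡ true → t ≡ t′)
  × (∀ s s′ t → M s t ≡ true → M s′ t ≡ true → s ≢ s′ → d ≤ ∣ toℕ s - toℕ s′ ∣)

IsMatchingSet : {n m : ℕ} → EdgeSet n m → Set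
IsMatchingSet M =
  (∀ s t t′ → M s t ≡ true → M s t′ ≡ true → t ≡ t′)
  × (∀ s s′ t → M s t ≡ true → M s′ t ≡ true → s ≡ s′)

adjExt : {n m : ℕ} (k : ℕ) → Adj n m → Adj (n + k) m
adjExt {n} k adj s t = [ (λ a → adj a t) , (λ _ → false) ]′ (splitAt n s)

wExt : {n m : ℕ} (k : ℕ) → Weight n m → Weight (n + k) m
wExt {n} k w s t = [ (λ a → w a t) , (λ _ → 0ℚ) ]′ (splitAt n s)

-- s lies in the cyclic window {s_j, s_{j+1}, …, s_{j+d-1}} (indices mod N),
-- for j < N.  Since j < N and d ≤ N in all relevant cases, "mod N" is
-- expressed exactly as:  s = j + r  or  s + N = j + r  for some r < d.
InWindow : (N d j : ℕ) → Fin N → Set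
InWindow N d j s = ∃ λ r → r < d × (toℕ s ≡ j + r ⊎ toℕ s + N ≡ j + r)

IsMatchingOfWindow : {N m : ℕ} → Adj N m → (d j : ℕ) → EdgeSet N m → Set
IsMatchingOfWindow {N} adj d j M =
  (∀ s t → M s t ≡ true → adj s t ≡ true × InWindow N d j s)
  × IsMatchingSet M

IsMaxWeightMatchingOfWindow : {N m : ℕ} → Adj N m → Weight N m → (d j : ℕ) → EdgeSet N m → Set
IsMaxWeightMatchingOfWindow adj w d j M =
  IsMatchingOfWindow adj d j M
  × (∀ M′ → IsMatchingOfWindow adj d j M′ → wt w M′ ℚ.≤ wt w M)

-- M_i = ⋃_{j=0}^{q-1} F_{i + j(2d-1)}, restricted to the original nodes
-- (the added nodes are isolated, so nothing is lost).  i is 0-based.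
unionM : {n m : ℕ} (k d q : ℕ) → (ℕ → EdgeSet (n + k) m) → ℕ → EdgeSet n m
unionM k d q F i s t = anyBelow q (λ j → F (i + j * (2 * d ∸ 1)) (s ↑ˡ k) t)

{-# OPTIONS --safe #-}
module Submission where

open import Defs
open import Data.Nat using (ℕ; NonZero; _+_; _*_; _∸_; _<_; _≤_)
open import Data.Nat.Divisibility using (_∣_; module _∣_)
open import Data.Fin using (Fin; toℕ)
open import Data.Bool using (true)
open import Data.Product using (_×_)
open import Data.Rational using (ℚ; 0ℚ; 1ℚ; _-_; _/_)
open import Data.Rational using () renaming (_≤_ to _≤ℚ_; _+_ to _+ℚ_; _*_ to _*ℚ_)
open import Data.Integer using (+_)
open import Relation.Binary.PropositionalEquality using (_≡_)

open import Algebra.Bundles using (CommutativeRing)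
open import Data.Bool using (Bool; false; if_then_else_; _∧_; _∨_)
open import Data.Bool.Properties using (if-cong; if-cong-then; if-eta; ¬-not)
open import Data.Empty using (⊥; ⊥-elim)
open import Data.Fin using (zero; suc; _↑ˡ_; _↑ʳ_; splitAt)
open import Data.Fin.Properties
  using (toℕ<n; toℕ-↑ˡ; toℕ-↑ʳ; toℕ-inject₁; toℕ-fromℕ; splitAt-↑ˡ; splitAt-↑ʳ; splitAt⁻¹-↑ˡ; ↑ˡ-injective)
import Data.Fin.Properties as Fin
import Data.Integer as ℤ
import Data.Integer.Properties as ℤ
open import Data.Nat using (zero; suc; s≤s; ∣_-_∣; _≤?_; _<?_; _≟_)
import Data.Nat.Properties as ℕ
open import Data.Product using (_,_; ∃; proj₁; proj₂)
open import Data.Rational using (toℚᵘ)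
import Data.Rational.Properties as ℚ
open import Data.Rational.Solver using (module +-*-Solver)
import Data.Rational.Unnormalised as ℚᵘ
import Data.Rational.Unnormalised.Properties as ℚᵘ
open import Data.Sum using (_⊎_; inj₁; inj₂; [_,_]′)
open import Function using (_∘_)
open import Function.Bundles using (mk⇔)
open import Relation.Binary.Definitions using (tri<; tri≈; tri>)
open import Relation.Binary.PropositionalEquality
  using (refl; sym; trans; cong; cong₂; subst; subst₂; _≢_; module ≡-Reasoning)
open import Relation.Nullary using (Dec; does; yes; no; _×-dec_)
open import Relation.Nullary.Decidable using (dec-true; dec-false; does-⇔)

open import Algebra.Properties.CommutativeMonoid.Sum ℚ.+-0-commutativeMonoid
  using (sum; sum-syntax; sum-cong-≗; sum-init-last; sum-replicate; sum-replicate-zero; ∑-comm; ∑-distrib-+)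
open import Algebra.Properties.Semiring.Mult (CommutativeRing.semiring ℚ.+-*-commutativeRing)
  using (×-homo-+; ×-assoc-*; ×-comm-*) renaming (_×_ to _·_)
open import Algebra.Properties.CommutativeSemigroup ℕ.+-commutativeSemigroup
  using (x∙yz≈y∙xz; xy∙z≈xz∙y)

-- The windows are the cyclic blocks of d consecutive nodes among the n + k nodes, and M_i
-- is built from the windows starting at i, i + (2d − 1), i + 2(2d − 1), … all round the
-- cycle.  Any two of these starts are at least 2d − 1 apart in both directions, so nodes of
-- different windows are at distance ≥ d and M_i is a d-distance matching.  Conversely, a
-- d-distance matching M* meets every window in an ordinary matching of H_x (the k ≥ d − 1
-- isolated nodes stop a window from wrapping round onto two real nodes), so its weight there
-- is at most w(F_x).  Every node lies in exactly d windows, hence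
-- d·w(M*) ≤ Σ_x w(F_x) = Σ_i w(M_i) ≤ (2d − 1)·w(M_{i*}).

-- Finite sums of rationals

∑-mono-≤ : ∀ {n} {f g : Fin n → ℚ} → (∀ i → f i ≤ℚ g i) → sum f ≤ℚ sum g
∑-mono-≤ {zero}  f≤g = ℚ.≤-refl
∑-mono-≤ {suc n} f≤g = ℚ.+-mono-≤ (f≤g zero) (∑-mono-≤ (f≤g ∘ suc))

∑-zero : ∀ {n} {f : Fin n → ℚ} → (∀ i → f i ≡ 0ℚ) → sum f ≡ 0ℚ
∑-zero {n} f≗0 = trans (sum-cong-≗ {n} f≗0) (sum-replicate-zero n)

∑-splitAt : ∀ a {b} (f : Fin (a + b) → ℚ) →
            sum f ≡ ∑[ i < a ] f (i ↑ˡ b) +ℚ ∑[ j < b ] f (a ↑ʳ j)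
∑-splitAt zero    f = sym (ℚ.+-identityˡ _)
∑-splitAt (suc a) {b} f = trans (cong (f zero +ℚ_) (∑-splitAt a (f ∘ suc)))
  (sym (ℚ.+-assoc (f zero) (∑[ i < a ] f (suc (i ↑ˡ b))) (∑[ j < b ] f (suc (a ↑ʳ j)))))

∑-split : ∀ a {b} (g : ℕ → ℚ) →
          ∑[ x < a + b ] g (toℕ x) ≡ ∑[ i < a ] g (toℕ i) +ℚ ∑[ j < b ] g (a + toℕ j)
∑-split a {b} g = trans (∑-splitAt a (g ∘ toℕ))
  (cong₂ _+ℚ_ (sum-cong-≗ {a} (λ i → cong g (toℕ-↑ˡ i b))) (sum-cong-≗ {b} (cong g ∘ toℕ-↑ʳ a)))

∑-snoc : ∀ q (g : ℕ → ℚ) → ∑[ j < suc q ] g (toℕ j) ≡ ∑[ j < q ] g (toℕ j) +ℚ g q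
∑-snoc q g = trans (sum-init-last {q} (g ∘ toℕ))
  (cong₂ _+ℚ_ (sum-cong-≗ {q} (cong g ∘ toℕ-inject₁)) (cong g (toℕ-fromℕ q)))

∑-blocks : ∀ q D (g : ℕ → ℚ) →
           ∑[ x < q * D ] g (toℕ x) ≡ ∑[ i < D ] ∑[ j < q ] g (toℕ i + toℕ j * D)
∑-blocks zero    D g = sym (sum-replicate-zero D)
∑-blocks (suc q) D g = begin
  ∑[ x < D + q * D ] g (toℕ x)
    ≡⟨ ∑-split D g ⟩
  ∑[ i < D ] g (toℕ i) +ℚ ∑[ y < q * D ] g (D + toℕ y)
    ≡⟨ cong (∑[ i < D ] g (toℕ i) +ℚ_) (∑-blocks q D (λ y → g (D + y))) ⟩
  ∑[ i < D ] g (toℕ i) +ℚ ∑[ i < D ] ∑[ j < q ] g (D + (toℕ i + toℕ j * D))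
    ≡⟨ ∑-distrib-+ {D} (g ∘ toℕ) (λ i → ∑[ j < q ] g (D + (toℕ i + toℕ j * D))) ⟨
  ∑[ i < D ] (g (toℕ i) +ℚ ∑[ j < q ] g (D + (toℕ i + toℕ j * D)))
    ≡⟨ sum-cong-≗ {D} (λ i → cong₂ _+ℚ_ (cong g (sym (ℕ.+-identityʳ (toℕ i))))
                                         (sum-cong-≗ {q} (λ j → cong g (x∙yz≈y∙xz D (toℕ i) (toℕ j * D))))) ⟩
  ∑[ i < D ] ∑[ j < suc q ] g (toℕ i + toℕ j * D)
    ∎
  where open ≡-Reasoning

if-∨-disjoint : ∀ a {b} (y : ℚ) → (a ≡ true → b ≡ false) →
                (if a ∨ b then y else 0ℚ) ≡ (if a then y else 0ℚ) +ℚ (if b then y else 0ℚ)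
if-∨-disjoint true  y a⇒¬b rewrite a⇒¬b refl = sym (ℚ.+-identityʳ y)
if-∨-disjoint false y _ = sym (ℚ.+-identityˡ _)

∑-if-∧ : ∀ {m} c (b : Fin m → Bool) (y : Fin m → ℚ) →
         ∑[ t < m ] (if c ∧ b t then y t else 0ℚ) ≡
         (if c then ∑[ t < m ] (if b t then y t else 0ℚ) else 0ℚ)
∑-if-∧     true  b y = refl
∑-if-∧ {m} false b y = sum-replicate-zero m

∧-true : ∀ {a b} → a ∧ b ≡ true → a ≡ true × b ≡ true
∧-true {true} b≡true = refl , b≡true

-- Weights of edge sets

sumFin≡sum : ∀ n (f : Fin n → ℚ) → sumFin n f ≡ sum f
sumFin≡sum zero    f = refl
sumFin≡sum (suc n) f = cong (f zero +ℚ_) (sumFin≡sum n (f ∘ suc))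

wt-at : ∀ {n m} → Weight n m → EdgeSet n m → Fin n → ℚ
wt-at {m = m} w M s = ∑[ t < m ] (if M s t then w s t else 0ℚ)

wt≡∑wt-at : ∀ {n m} (w : Weight n m) M → wt w M ≡ ∑[ s < n ] wt-at w M s
wt≡∑wt-at {n} {m} w M = trans (sumFin≡sum n _) (sum-cong-≗ {n} (λ s → sumFin≡sum m _))

anyBelow-witness : ∀ q {f : ℕ → Bool} → anyBelow q f ≡ true → ∃ λ j → j < q × f j ≡ true
anyBelow-witness (suc q) {f} e with anyBelow q f in below | f q in last
... | true  | _    = let (j , j<q , fj) = anyBelow-witness q below in j , ℕ.m<n⇒m<1+n j<q , fj
... | false | true = q , ℕ.≤-refl , last

[,]-splitAt-↑ˡ : ∀ {A : Set} {n k} (f : Fin n → A) (g : Fin k → A) a →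
                 [ f , g ]′ (splitAt n (a ↑ˡ k)) ≡ f a
[,]-splitAt-↑ˡ {n = n} {k} f g a = cong [ f , g ]′ (splitAt-↑ˡ n a k)

[,]-splitAt-↑ʳ : ∀ {A : Set} {n k} (f : Fin n → A) (g : Fin k → A) b →
                 [ f , g ]′ (splitAt n (n ↑ʳ b)) ≡ g b
[,]-splitAt-↑ʳ {n = n} {k} f g b = cong [ f , g ]′ (splitAt-↑ʳ n k b)

extend : ∀ {n m} k → EdgeSet n m → EdgeSet (n + k) m
extend {n} k M s t = [ (λ a → M a t) , (λ _ → false) ]′ (splitAt n s)

extend-true : ∀ {n m} k {M : EdgeSet n m} {s t} → extend k M s t ≡ true →
              ∃ λ a → a ↑ˡ k ≡ s × M a t ≡ true
extend-true {n} k {s = s} e with splitAt n s in split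
... | inj₁ a = a , splitAt⁻¹-↑ˡ split , e

Disjoint : ∀ {n m} → EdgeSet n m → EdgeSet n m → Set
Disjoint A B = ∀ s t → A s t ≡ true → B s t ≡ false

module _ {n m : ℕ} (w : Weight n m) where

  wt-cong : ∀ {A B} → (∀ s t → A s t ≡ B s t) → wt w A ≡ wt w B
  wt-cong {A} {B} A≗B = trans (wt≡∑wt-at w A) (trans
    (sum-cong-≗ {n} (λ s → sum-cong-≗ {m} (λ t → if-cong (A≗B s t))))
    (sym (wt≡∑wt-at w B)))

  wt-∅ : wt w (λ _ _ → false) ≡ 0ℚ
  wt-∅ = trans (wt≡∑wt-at w _) (∑-zero {n} (λ _ → sum-replicate-zero m))

  wt-∪ : ∀ {A B} → Disjoint A B → wt w (λ s t → A s t ∨ B s t) ≡ wt w A +ℚ wt w B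
  wt-∪ {A} {B} A∩B=∅ = begin
    wt w (λ s t → A s t ∨ B s t)                     ≡⟨ wt≡∑wt-at w _ ⟩
    ∑[ s < n ] wt-at w (λ s t → A s t ∨ B s t) s     ≡⟨ sum-cong-≗ {n} at-∪ ⟩
    ∑[ s < n ] (wt-at w A s +ℚ wt-at w B s)          ≡⟨ ∑-distrib-+ {n} _ _ ⟩
    ∑[ s < n ] wt-at w A s +ℚ ∑[ s < n ] wt-at w B s ≡⟨ cong₂ _+ℚ_ (wt≡∑wt-at w A) (wt≡∑wt-at w B) ⟨
    wt w A +ℚ wt w B                                 ∎
    where
    open ≡-Reasoning
    at-∪ : ∀ s → wt-at w (λ s t → A s t ∨ B s t) s ≡ wt-at w A s +ℚ wt-at w B s
    at-∪ s = trans (sum-cong-≗ {m} (λ t → if-∨-disjoint (A s t) (w s t) (A∩B=∅ s t)))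
                   (∑-distrib-+ {m} _ _)

  wt-anyBelow : ∀ q (M : ℕ → EdgeSet n m) →
                (∀ {i j s t} → i < q → j < q → M i s t ≡ true → M j s t ≡ true → i ≡ j) →
                wt w (λ s t → anyBelow q (λ j → M j s t)) ≡ ∑[ j < q ] wt w (M (toℕ j))
  wt-anyBelow zero    M _    = wt-∅
  wt-anyBelow (suc q) M once = begin
    wt w (λ s t → anyBelow q (λ j → M j s t) ∨ M q s t)
      ≡⟨ wt-∪ earlier∩last ⟩
    wt w (λ s t → anyBelow q (λ j → M j s t)) +ℚ wt w (M q)
      ≡⟨ cong (_+ℚ wt w (M q)) (wt-anyBelow q M (λ i<q j<q → once (ℕ.m<n⇒m<1+n i<q) (ℕ.m<n⇒m<1+n j<q))) ⟩
    ∑[ j < q ] wt w (M (toℕ j)) +ℚ wt w (M q)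
      ≡⟨ ∑-snoc q (wt w ∘ M) ⟨
    ∑[ j < suc q ] wt w (M (toℕ j))
      ∎
    where
    open ≡-Reasoning
    earlier∩last : Disjoint (λ s t → anyBelow q (λ j → M j s t)) (M q)
    earlier∩last s t below with anyBelow-witness q below
    ... | j , j<q , Mj = ¬-not (λ Mq → ℕ.<-irrefl (once (ℕ.m<n⇒m<1+n j<q) ℕ.≤-refl Mj Mq) j<q)

module _ {n m : ℕ} (k : ℕ) (w : Weight n m) where

  wt-wExt : ∀ (M : EdgeSet (n + k) m) → wt (wExt k w) M ≡ wt w (λ a → M (a ↑ˡ k))
  wt-wExt M = begin
    wt (wExt k w) M                    ≡⟨ trans (wt≡∑wt-at (wExt k w) M) (∑-splitAt n _) ⟩
    real +ℚ padding                    ≡⟨ cong₂ _+ℚ_ real≡restriction padding≡0 ⟩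
    wt w (λ a → M (a ↑ˡ k)) +ℚ 0ℚ      ≡⟨ ℚ.+-identityʳ _ ⟩
    wt w (λ a → M (a ↑ˡ k))            ∎
    where
    open ≡-Reasoning
    real padding : ℚ
    real    = ∑[ a < n ] ∑[ t < m ] (if M (a ↑ˡ k) t then wExt k w (a ↑ˡ k) t else 0ℚ)
    padding = ∑[ b < k ] ∑[ t < m ] (if M (n ↑ʳ b) t then wExt k w (n ↑ʳ b) t else 0ℚ)
    real≡restriction : real ≡ wt w (λ a → M (a ↑ˡ k))
    real≡restriction = trans
      (sum-cong-≗ {n} (λ a → sum-cong-≗ {m} (λ t →
        if-cong-then (M (a ↑ˡ k) t) ([,]-splitAt-↑ˡ {k = k} (λ a → w a t) _ a))))
      (sym (wt≡∑wt-at w _))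
    padding≡0 : padding ≡ 0ℚ
    padding≡0 = ∑-zero {k} (λ b → ∑-zero {m} (λ t →
      trans (if-cong-then (M (n ↑ʳ b) t) ([,]-splitAt-↑ʳ {n = n} (λ a → w a t) _ b))
            (if-eta (M (n ↑ʳ b) t))))

  wt-extend : ∀ (M : EdgeSet n m) → wt (wExt k w) (extend k M) ≡ wt w M
  wt-extend M = trans (wt-wExt (extend k M)) (wt-cong w (λ a t → [,]-splitAt-↑ˡ (λ a → M a t) _ a))

-- Cyclic windows

witness : ∀ {A : Set} (a? : Dec A) → does a? ≡ true → A
witness (yes a) _ = a

inRange? : (d x p : ℕ) → Dec (x ≤ p × p < x + d)
inRange? d x p = x ≤? p ×-dec p <? x + d

inRange-offset : ∀ {d x p} → x ≤ p × p < x + d → ∃ λ r → r < d × p ≡ x + r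
inRange-offset {d} {x} {p} (x≤p , p<x+d) =
  p ∸ x , ℕ.+-cancelˡ-< x (p ∸ x) d (subst (_< x + d) (sym x+[p∸x]≡p) p<x+d) , sym x+[p∸x]≡p
  where
  x+[p∸x]≡p : x + (p ∸ x) ≡ p
  x+[p∸x]≡p = ℕ.m+[n∸m]≡n x≤p

inRange-close : ∀ {d x p₁ p₂} → x ≤ p₁ × p₁ < x + d → x ≤ p₂ × p₂ < x + d → ∣ p₁ - p₂ ∣ < d
inRange-close {d} {x} in₁ in₂ with inRange-offset in₁ | inRange-offset in₂
... | r₁ , r₁<d , refl | r₂ , r₂<d , refl =
  subst (_< d) (sym (ℕ.∣m+n-m+o∣≡∣n-o∣ x r₁ r₂))
        (ℕ.≤-<-trans (ℕ.∣m-n∣≤m⊔n r₁ r₂) (ℕ.⊔-lub r₁<d r₂<d))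

inRange-shift : ∀ N {d x p} → does (inRange? d (N + x) (N + p)) ≡ does (inRange? d x p)
inRange-shift N {d} {x} {p} = does-⇔ (mk⇔ cancel shift) (inRange? d (N + x) (N + p)) (inRange? d x p)
  where
  cancel : N + x ≤ N + p × N + p < N + x + d → x ≤ p × p < x + d
  cancel (le , lt) =
    ℕ.+-cancelˡ-≤ N x p le , ℕ.+-cancelˡ-< N p (x + d) (subst (N + p <_) (ℕ.+-assoc N x d) lt)
  shift : x ≤ p × p < x + d → N + x ≤ N + p × N + p < N + x + d
  shift (le , lt) = ℕ.+-monoʳ-≤ N le , subst (N + p <_) (sym (ℕ.+-assoc N x d)) (ℕ.+-monoʳ-< N lt)

∑-inRange : ∀ {a p} d (y : ℚ) → d ≤ suc p → p < a →
            ∑[ x < a ] (if does (inRange? d (toℕ x) p) then y else 0ℚ) ≡ d · y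
∑-inRange {a} {p} d y d≤1+p p<a = begin
  ∑[ x < a ] f (toℕ x)
    ≡⟨ cong (λ a → ∑[ x < a ] f (toℕ x)) a≡c+[d+e] ⟩
  ∑[ x < c + (d + e) ] f (toℕ x)
    ≡⟨ ∑-split c f ⟩
  ∑[ x < c ] f (toℕ x) +ℚ ∑[ u < d + e ] f (c + toℕ u)
    ≡⟨ cong (∑[ x < c ] f (toℕ x) +ℚ_) (∑-split d (λ u → f (c + u))) ⟩
  ∑[ x < c ] f (toℕ x) +ℚ (∑[ u < d ] f (c + toℕ u) +ℚ ∑[ v < e ] f (c + (d + toℕ v)))
    ≡⟨ cong₂ _+ℚ_ (∑-zero {c} (λ x → before (toℕ x) (toℕ<n x)))
                  (cong₂ _+ℚ_ (sum-cong-≗ {d} (λ u → inside (toℕ u) (toℕ<n u))) (∑-zero {e} (after ∘ toℕ))) ⟩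
  0ℚ +ℚ (∑[ _ < d ] y +ℚ 0ℚ)
    ≡⟨ trans (ℚ.+-identityˡ _) (ℚ.+-identityʳ _) ⟩
  ∑[ _ < d ] y
    ≡⟨ sum-replicate d {y} ⟩
  d · y
    ∎
  where
  open ≡-Reasoning
  f : ℕ → ℚ
  f x = if does (inRange? d x p) then y else 0ℚ
  c e : ℕ
  c = suc p ∸ d
  e = a ∸ suc p
  c+d≡1+p : c + d ≡ suc p
  c+d≡1+p = ℕ.m∸n+n≡m d≤1+p
  a≡c+[d+e] : a ≡ c + (d + e)
  a≡c+[d+e] = trans (sym (ℕ.m+[n∸m]≡n p<a)) (trans (cong (_+ e) (sym c+d≡1+p)) (ℕ.+-assoc c d e))
  before : ∀ x → x < c → f x ≡ 0ℚ
  before x x<c = if-cong (dec-false (inRange? d x p) λ (_ , p<x+d) →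
    ℕ.<⇒≱ p<x+d (ℕ.≤-pred (subst (suc x + d ≤_) c+d≡1+p (ℕ.+-monoˡ-≤ d x<c))))
  inside : ∀ u → u < d → f (c + u) ≡ y
  inside u u<d = if-cong (dec-true (inRange? d (c + u) p)
    ( ℕ.≤-pred (subst (suc (c + u) ≤_) c+d≡1+p (subst (_≤ c + d) (ℕ.+-suc c u) (ℕ.+-monoʳ-≤ c u<d)))
    , subst (_≤ c + u + d) c+d≡1+p (ℕ.+-monoˡ-≤ d (ℕ.m≤m+n c u))))
  after : ∀ v → f (c + (d + v)) ≡ 0ℚ
  after v = if-cong (dec-false (inRange? d (c + (d + v)) p) λ (c+d+v≤p , _) →
    ℕ.<⇒≱ (subst (p <_) (trans (cong (_+ v) (sym c+d≡1+p)) (ℕ.+-assoc c d v)) (ℕ.m≤m+n (suc p) v))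
          c+d+v≤p)

inWindow : (N d x s : ℕ) → Bool
inWindow N d x s = does (inRange? d x s) ∨ does (inRange? d x (N + s))

-- Shifting the windows containing s by N turns the count into that of the windows containing
-- N + s among the 2N starting points x < 2N, none of which wraps round.
∑-inWindow : ∀ {N d s} (y : ℚ) → d ≤ N → s < N →
             ∑[ x < N ] (if inWindow N d (toℕ x) s then y else 0ℚ) ≡ d · y
∑-inWindow {N} {d} {s} y d≤N s<N = begin
  ∑[ x < N ] (if inWindow N d (toℕ x) s then y else 0ℚ)
    ≡⟨ sum-cong-≗ {N} (λ x → if-∨-disjoint (does (inRange? d (toℕ x) s)) y (near⇒¬far (toℕ x))) ⟩
  ∑[ x < N ] (near (toℕ x) +ℚ far (toℕ x))
    ≡⟨ ∑-distrib-+ {N} _ _ ⟩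
  ∑[ x < N ] near (toℕ x) +ℚ ∑[ x < N ] far (toℕ x)
    ≡⟨ ℚ.+-comm (∑[ x < N ] near (toℕ x)) (∑[ x < N ] far (toℕ x)) ⟩
  ∑[ x < N ] far (toℕ x) +ℚ ∑[ x < N ] near (toℕ x)
    ≡⟨ cong (∑[ x < N ] far (toℕ x) +ℚ_) (sum-cong-≗ {N} (λ x → if-cong (sym (inRange-shift N)))) ⟩
  ∑[ x < N ] far (toℕ x) +ℚ ∑[ x < N ] far (N + toℕ x)
    ≡⟨ ∑-split N far ⟨
  ∑[ x < N + N ] far (toℕ x)
    ≡⟨ ∑-inRange d y (ℕ.≤-trans d≤N (ℕ.m≤n⇒m≤1+n (ℕ.m≤m+n N s))) (ℕ.+-monoʳ-< N s<N) ⟩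
  d · y
    ∎
  where
  open ≡-Reasoning
  near far : ℕ → ℚ
  near x = if does (inRange? d x s) then y else 0ℚ
  far x = if does (inRange? d x (N + s)) then y else 0ℚ
  near⇒¬far : ∀ x → does (inRange? d x s) ≡ true → does (inRange? d x (N + s)) ≡ false
  near⇒¬far x near = dec-false (inRange? d x (N + s)) λ (_ , N+s<x+d) →
    ℕ.<⇒≱ N+s<x+d (subst (x + d ≤_) (ℕ.+-comm s N)
                         (ℕ.+-mono-≤ (proj₁ (witness (inRange? d x s) near)) d≤N))

inWindow-cases : ∀ {N d x s} → inWindow N d x s ≡ true →
                 (x ≤ s × s < x + d) ⊎ (x ≤ N + s × N + s < x + d)
inWindow-cases {N} {d} {x} {s} e with does (inRange? d x s) in near
... | true  = inj₁ (witness (inRange? d x s) near)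
... | false = inj₂ (witness (inRange? d x (N + s)) e)

inWindow-sound : ∀ {N d x} (s : Fin N) → inWindow N d x (toℕ s) ≡ true → InWindow N d x s
inWindow-sound {N} {d} {x} s e with inWindow-cases {N} {d} {x} e
... | inj₁ near = let (r , r<d , eq) = inRange-offset near in r , r<d , inj₁ eq
... | inj₂ far  = let (r , r<d , eq) = inRange-offset far
                  in r , r<d , inj₂ (trans (ℕ.+-comm (toℕ s) N) eq)

-- The padding n + (d − 1) ≤ N, i.e. k ≥ d − 1, is what rules out a window that wraps round
-- from one real node onto another.
near-far-⊥ : ∀ {n N d′ x a b} → n + d′ ≤ N → a < n →
             x ≤ a × a < x + suc d′ → x ≤ N + b × N + b < x + suc d′ → ⊥
near-far-⊥ {n} {N} {d′} {x} {a} {b} n+d′≤N a<n (x≤a , _) (_ , N+b<x+d) = ℕ.<⇒≱ N+b<x+d (begin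
  x + suc d′  ≤⟨ ℕ.+-monoˡ-≤ (suc d′) x≤a ⟩
  a + suc d′  ≡⟨ ℕ.+-suc a d′ ⟩
  suc a + d′  ≤⟨ ℕ.+-monoˡ-≤ d′ a<n ⟩
  n + d′      ≤⟨ n+d′≤N ⟩
  N           ≤⟨ ℕ.m≤m+n N b ⟩
  N + b       ∎)
  where open ℕ.≤-Reasoning

inWindow-close : ∀ {n N d′ x a₁ a₂} → n + d′ ≤ N → a₁ < n → a₂ < n →
                 inWindow N (suc d′) x a₁ ≡ true → inWindow N (suc d′) x a₂ ≡ true → ∣ a₁ - a₂ ∣ < suc d′
inWindow-close {n} {N} {d′} {x} {a₁} {a₂} n+d′≤N a₁<n a₂<n e₁ e₂
  with inWindow-cases {N} {suc d′} {x} e₁ | inWindow-cases {N} {suc d′} {x} e₂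
... | inj₁ near₁ | inj₁ near₂ = inRange-close near₁ near₂
... | inj₁ near₁ | inj₂ far₂  = ⊥-elim (near-far-⊥ n+d′≤N a₁<n near₁ far₂)
... | inj₂ far₁  | inj₁ near₂ = ⊥-elim (near-far-⊥ n+d′≤N a₂<n near₂ far₁)
... | inj₂ far₁  | inj₂ far₂  = subst (_< suc d′) (ℕ.∣m+n-m+o∣≡∣n-o∣ N a₁ a₂) (inRange-close far₁ far₂)

≤∣-∣ : ∀ {a b d} → a + d ≤ b → d ≤ ∣ a - b ∣
≤∣-∣ {a} {b} {d} a+d≤b = subst (d ≤_) (sym (ℕ.m≤n⇒∣m-n∣≡n∸m (ℕ.m+n≤o⇒m≤o a a+d≤b)))
  (ℕ.m+n≤o⇒m≤o∸n d (subst (_≤ b) (ℕ.+-comm a d) a+d≤b))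

wraps-apart : ∀ {N d p₁ p₂ s₁ s₂} → p₁ + d ≤ p₂ → p₂ + d ≤ p₁ + N → s₂ < N →
              (s₁ ≡ p₁ ⊎ s₁ + N ≡ p₁) → (s₂ ≡ p₂ ⊎ s₂ + N ≡ p₂) → d ≤ ∣ s₁ - s₂ ∣
wraps-apart l₁ l₂ s₂<N (inj₁ refl) (inj₁ refl) = ≤∣-∣ l₁
wraps-apart {N} {d} {p₂ = p₂} {s₁} {s₂} l₁ l₂ s₂<N (inj₁ refl) (inj₂ e₂) =
  subst (d ≤_) (ℕ.∣-∣-comm s₂ s₁) (≤∣-∣ (ℕ.+-cancelʳ-≤ N (s₂ + d) s₁ (begin
    s₂ + d + N  ≡⟨ xy∙z≈xz∙y s₂ d N ⟩
    s₂ + N + d  ≡⟨ cong (_+ d) e₂ ⟩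
    p₂ + d      ≤⟨ l₂ ⟩
    s₁ + N      ∎)))
  where open ℕ.≤-Reasoning
wraps-apart {N} {d} {p₁} {s₁ = s₁} {s₂} l₁ l₂ s₂<N (inj₂ e₁) (inj₁ refl) = ⊥-elim (ℕ.<⇒≱ s₂<N (begin
  N           ≤⟨ ℕ.m≤n+m N s₁ ⟩
  s₁ + N      ≡⟨ e₁ ⟩
  p₁          ≤⟨ ℕ.m≤m+n p₁ d ⟩
  p₁ + d      ≤⟨ l₁ ⟩
  s₂          ∎))
  where open ℕ.≤-Reasoning
wraps-apart {N} {d} {p₁} {p₂} {s₁} {s₂} l₁ l₂ s₂<N (inj₂ e₁) (inj₂ e₂) =
  ≤∣-∣ (ℕ.+-cancelʳ-≤ N (s₁ + d) s₂ (begin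
    s₁ + d + N  ≡⟨ xy∙z≈xz∙y s₁ d N ⟩
    s₁ + N + d  ≡⟨ cong (_+ d) e₁ ⟩
    p₁ + d      ≤⟨ l₁ ⟩
    p₂          ≡⟨ e₂ ⟨
    s₂ + N      ∎))
  where open ℕ.≤-Reasoning

windows-apart : ∀ {N d′ x₁ x₂} {s₁ s₂ : Fin N} →
                x₁ + (suc d′ + d′) ≤ x₂ → x₂ + (suc d′ + d′) ≤ x₁ + N →
                InWindow N (suc d′) x₁ s₁ → InWindow N (suc d′) x₂ s₂ → suc d′ ≤ ∣ toℕ s₁ - toℕ s₂ ∣
windows-apart {N} {d′} {x₁} {x₂} {s₂ = s₂} x₁+D≤x₂ x₂+D≤x₁+N (r₁ , r₁<d , e₁) (r₂ , r₂<d , e₂) =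
  wraps-apart p₁+d≤p₂ p₂+d≤p₁+N (toℕ<n s₂) e₁ e₂
  where
  open ℕ.≤-Reasoning
  window-end : ∀ x {r} → r < suc d′ → x + r + suc d′ ≤ x + (suc d′ + d′)
  window-end x {r} r<d = begin
    x + r + suc d′    ≡⟨ ℕ.+-assoc x r (suc d′) ⟩
    x + (r + suc d′)  ≤⟨ ℕ.+-monoʳ-≤ x (ℕ.+-monoˡ-≤ (suc d′) (ℕ.≤-pred r<d)) ⟩
    x + (d′ + suc d′) ≡⟨ cong (_+_ x) (ℕ.+-comm d′ (suc d′)) ⟩
    x + (suc d′ + d′) ∎
  p₁+d≤p₂ : x₁ + r₁ + suc d′ ≤ x₂ + r₂
  p₁+d≤p₂ = ℕ.≤-trans (window-end x₁ r₁<d) (ℕ.≤-trans x₁+D≤x₂ (ℕ.m≤m+n x₂ r₂))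
  p₂+d≤p₁+N : x₂ + r₂ + suc d′ ≤ x₁ + r₁ + N
  p₂+d≤p₁+N = ℕ.≤-trans (window-end x₂ r₂<d) (ℕ.≤-trans x₂+D≤x₁+N (ℕ.+-monoˡ-≤ N (ℕ.m≤m+n x₁ r₁)))

-- The ratio 2 − 1/d

toℚᵘ-·1 : ∀ n → toℚᵘ (n · 1ℚ) ℚᵘ.≃ ℚᵘ.mkℚᵘ (+ n) 0
toℚᵘ-·1 zero    = ℚᵘ.≃-refl
toℚᵘ-·1 (suc n) = ℚᵘ.≃-trans (ℚ.toℚᵘ-homo-+ 1ℚ (n · 1ℚ))
  (ℚᵘ.≃-trans (ℚᵘ.+-congʳ (toℚᵘ 1ℚ) (toℚᵘ-·1 n)) (ℚᵘ.*≡* (trans (ℤ.*-identityʳ _)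
    (trans (cong (ℤ._+_ (+ 1)) (ℤ.*-identityʳ (+ n))) (sym (ℤ.*-identityʳ (+ suc n)))))))

d·[1/d]≡1 : ∀ d′ → suc d′ · (+ 1 / suc d′) ≡ 1ℚ
d·[1/d]≡1 d′ = begin
  d · δ          ≡⟨ cong (d ·_) (ℚ.*-identityˡ δ) ⟨
  d · (1ℚ *ℚ δ)  ≡⟨ ×-assoc-* d 1ℚ δ ⟨
  d · 1ℚ *ℚ δ    ≡⟨ ℚ.toℚᵘ-injective d·1*δ≃1 ⟩
  1ℚ             ∎
  where
  open ≡-Reasoning
  d : ℕ
  d = suc d′
  δ : ℚ
  δ = + 1 / d
  d·1*δ≃1 : toℚᵘ (d · 1ℚ *ℚ δ) ℚᵘ.≃ toℚᵘ 1ℚ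
  d·1*δ≃1 = ℚᵘ.≃-trans (ℚ.toℚᵘ-homo-* (d · 1ℚ) δ)
    (ℚᵘ.≃-trans (ℚᵘ.*-cong (toℚᵘ-·1 d) (ℚ.toℚᵘ-fromℚᵘ (ℚᵘ.mkℚᵘ (+ 1) d′)))
                (ℚᵘ.*-inverseʳ (ℚᵘ.mkℚᵘ (+ d) 0)))

d·x≤[2d-1]·y⇒x≤[2-1/d]*y : ∀ d′ {x y} → suc d′ · x ≤ℚ (suc d′ + d′) · y →
                           x ≤ℚ ((1ℚ +ℚ 1ℚ) - (+ 1 / suc d′)) *ℚ y
d·x≤[2d-1]·y⇒x≤[2-1/d]*y d′ {x} {y} d·x≤D·y = begin
  x                        ≡⟨ trans (sym (ℚ.*-identityˡ x)) (cong (_*ℚ x) (sym (d·[1/d]≡1 d′))) ⟩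
  d · δ *ℚ x               ≡⟨ pull-δ d x ⟨
  δ *ℚ (d · x)             ≤⟨ ℚ.*-monoˡ-≤-nonNeg δ {{ℚ.normalize-nonNeg 1 d}} d·x≤D·y ⟩
  δ *ℚ ((d + d′) · y)      ≡⟨ pull-δ (d + d′) y ⟩
  (d + d′) · δ *ℚ y        ≡⟨ cong (_*ℚ y) [d+d′]·δ≡2-δ ⟩
  ((1ℚ +ℚ 1ℚ) - δ) *ℚ y    ∎
  where
  open ℚ.≤-Reasoning
  d : ℕ
  d = suc d′
  δ : ℚ
  δ = + 1 / d
  pull-δ : ∀ k z → δ *ℚ (k · z) ≡ k · δ *ℚ z
  pull-δ k z = trans (×-comm-* k δ z) (sym (×-assoc-* k δ z))
  -- The last step reads 1ℚ as d · δ, which unfolds to δ +ℚ d′ · δ.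
  [d+d′]·δ≡2-δ : (d + d′) · δ ≡ (1ℚ +ℚ 1ℚ) - δ
  [d+d′]·δ≡2-δ = begin-equality
    (d + d′) · δ                  ≡⟨ ×-homo-+ δ d d′ ⟩
    d · δ +ℚ d′ · δ               ≡⟨ cong (_+ℚ d′ · δ) (d·[1/d]≡1 d′) ⟩
    1ℚ +ℚ d′ · δ
      ≡⟨ solve 2 (λ δ a → con 1ℚ :+ a := (con 1ℚ :+ (δ :+ a)) :- δ) refl δ (d′ · δ) ⟩
    (1ℚ +ℚ (δ +ℚ d′ · δ)) - δ     ≡⟨ cong (λ z → (1ℚ +ℚ z) - δ) (d·[1/d]≡1 d′) ⟩
    (1ℚ +ℚ 1ℚ) - δ                ∎
    where open +-*-Solver

-- The approximation argument

module Approximation {n m : ℕ} (adj : Adj n m) (w : Weight n m) (d′ k q : ℕ) (d′≤k : d′ ≤ k)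
  (n+k≡q*D : n + k ≡ q * (2 * suc d′ ∸ 1)) (F : ℕ → EdgeSet (n + k) m)
  (F-max : ∀ j → j < n + k → IsMaxWeightMatchingOfWindow (adjExt k adj) (wExt k w) (suc d′) j (F j))
  where

  d D N : ℕ
  d = suc d′
  D = 2 * d ∸ 1
  N = n + k

  D≡d+d′ : D ≡ d + d′
  D≡d+d′ = trans (ℕ.+-suc d′ (d′ + 0)) (cong suc (cong (_+_ d′) (ℕ.+-identityʳ d′)))

  M : ℕ → EdgeSet n m
  M = unionM k d q F

  F-edges : ∀ {x s t} → x < N → F x s t ≡ true → adjExt k adj s t ≡ true × InWindow N d x s
  F-edges x<N = proj₁ (proj₁ (F-max _ x<N)) _ _

  F-matching : ∀ {x} → x < N → IsMatchingSet (F x)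
  F-matching x<N = proj₂ (proj₁ (F-max _ x<N))

  F-optimal : ∀ {x M′} → x < N → IsMatchingOfWindow (adjExt k adj) d x M′ →
              wt (wExt k w) M′ ≤ℚ wt (wExt k w) (F x)
  F-optimal x<N = proj₂ (F-max _ x<N) _

  start<N : ∀ {i j} → i < D → j < q → i + j * D < N
  start<N {i} {j} i<D j<q =
    subst (i + j * D <_) (sym n+k≡q*D) (ℕ.≤-trans (ℕ.+-monoˡ-< (j * D) i<D) (ℕ.*-monoˡ-≤ D j<q))

  next-start : ∀ i j → i + j * D + (d + d′) ≡ i + suc j * D
  next-start i j = trans (cong (_+_ (i + j * D)) (sym D≡d+d′))
                         (trans (ℕ.+-assoc i (j * D) D) (cong (_+_ i) (ℕ.+-comm (j * D) D)))

  ordered-windows-apart : ∀ {i j₁ j₂ s₁ s₂ t₁ t₂} → i < D → j₁ < j₂ → j₂ < q →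
                          F (i + j₁ * D) s₁ t₁ ≡ true → F (i + j₂ * D) s₂ t₂ ≡ true → d ≤ ∣ toℕ s₁ - toℕ s₂ ∣
  ordered-windows-apart {i} {j₁} {j₂} i<D j₁<j₂ j₂<q e₁ e₂ =
    windows-apart gap wrapped-gap (proj₂ (F-edges (start<N i<D (ℕ.<-trans j₁<j₂ j₂<q)) e₁))
                                  (proj₂ (F-edges (start<N i<D j₂<q) e₂))
    where
    open ℕ.≤-Reasoning
    gap : i + j₁ * D + (d + d′) ≤ i + j₂ * D
    gap = begin
      i + j₁ * D + (d + d′)  ≡⟨ next-start i j₁ ⟩
      i + suc j₁ * D         ≤⟨ ℕ.+-monoʳ-≤ i (ℕ.*-monoˡ-≤ D j₁<j₂) ⟩
      i + j₂ * D             ∎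
    wrapped-gap : i + j₂ * D + (d + d′) ≤ i + j₁ * D + N
    wrapped-gap = begin
      i + j₂ * D + (d + d′)  ≡⟨ next-start i j₂ ⟩
      i + suc j₂ * D         ≤⟨ ℕ.+-monoʳ-≤ i (ℕ.*-monoˡ-≤ D j₂<q) ⟩
      i + q * D              ≡⟨ cong (_+_ i) n+k≡q*D ⟨
      i + N                  ≤⟨ ℕ.+-monoˡ-≤ N (ℕ.m≤m+n i (j₁ * D)) ⟩
      i + j₁ * D + N         ∎

  windows-of-M-apart : ∀ {i j₁ j₂ s₁ s₂ t₁ t₂} → i < D → j₁ ≢ j₂ → j₁ < q → j₂ < q →
                       F (i + j₁ * D) s₁ t₁ ≡ true → F (i + j₂ * D) s₂ t₂ ≡ true → d ≤ ∣ toℕ s₁ - toℕ s₂ ∣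
  windows-of-M-apart {j₁ = j₁} {j₂} {s₁} {s₂} i<D j₁≢j₂ j₁<q j₂<q e₁ e₂ with ℕ.<-cmp j₁ j₂
  ... | tri< j₁<j₂ _ _ = ordered-windows-apart i<D j₁<j₂ j₂<q e₁ e₂
  ... | tri≈ _ j₁≡j₂ _ = ⊥-elim (j₁≢j₂ j₁≡j₂)
  ... | tri> _ _ j₂<j₁ =
    subst (d ≤_) (ℕ.∣-∣-comm (toℕ s₂) (toℕ s₁)) (ordered-windows-apart i<D j₂<j₁ j₁<q e₂ e₁)

  window-of-M-unique : ∀ {i j₁ j₂ s t₁ t₂} → i < D → j₁ < q → j₂ < q →
                       F (i + j₁ * D) s t₁ ≡ true → F (i + j₂ * D) s t₂ ≡ true → j₁ ≡ j₂
  window-of-M-unique {j₁ = j₁} {j₂} {s} i<D j₁<q j₂<q e₁ e₂ with j₁ ≟ j₂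
  ... | yes j₁≡j₂ = j₁≡j₂
  ... | no j₁≢j₂ with subst (d ≤_) (ℕ.∣n-n∣≡0 (toℕ s)) (windows-of-M-apart i<D j₁≢j₂ j₁<q j₂<q e₁ e₂)
  ...   | ()

  M-isDDistanceMatching : ∀ {i} → i < D → IsDDistanceMatching d adj (M i)
  M-isDDistanceMatching {i} i<D = edges , one-per-node , apart
    where
    edges : SubsetOfEdges adj (M i)
    edges s t e with anyBelow-witness q e
    ... | j , j<q , Fj =
      trans (sym ([,]-splitAt-↑ˡ (λ a → adj a t) _ s)) (proj₁ (F-edges (start<N i<D j<q) Fj))
    one-per-node : ∀ s t t′ → M i s t ≡ true → M i s t′ ≡ true → t ≡ t′
    one-per-node s t t′ e e′ with anyBelow-witness q e | anyBelow-witness q e′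
    ... | j , j<q , Fj | j′ , j′<q , Fj′ with window-of-M-unique i<D j<q j′<q Fj Fj′
    ...   | refl = proj₁ (F-matching (start<N i<D j<q)) _ t t′ Fj Fj′
    apart : ∀ s s′ t → M i s t ≡ true → M i s′ t ≡ true → s ≢ s′ → d ≤ ∣ toℕ s - toℕ s′ ∣
    apart s s′ t e e′ s≢s′ with anyBelow-witness q e | anyBelow-witness q e′
    ... | j , j<q , Fj | j′ , j′<q , Fj′ with j ≟ j′
    ...   | yes refl =
      ⊥-elim (s≢s′ (↑ˡ-injective k s s′ (proj₂ (F-matching (start<N i<D j<q)) _ _ t Fj Fj′)))
    ...   | no j≢j′  = subst₂ (λ a b → d ≤ ∣ a - b ∣) (toℕ-↑ˡ s k) (toℕ-↑ˡ s′ k)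
                              (windows-of-M-apart i<D j≢j′ j<q j′<q Fj Fj′)

  wt-M : ∀ {i} → i < D → wt w (M i) ≡ ∑[ j < q ] wt (wExt k w) (F (i + toℕ j * D))
  wt-M {i} i<D = trans (wt-anyBelow w q (λ j a t → F (i + j * D) (a ↑ˡ k) t) (window-of-M-unique i<D))
                       (sum-cong-≗ {q} (λ j → sym (wt-wExt k w (F (i + toℕ j * D)))))

  module _ (M* : EdgeSet n m) (M*-dist : IsDDistanceMatching d adj M*) where

    window-part : ℕ → EdgeSet n m
    window-part x a t = inWindow N d x (toℕ a) ∧ M* a t

    window-part-true : ∀ {x s t} → extend k (window-part x) s t ≡ true →
                       ∃ λ a → a ↑ˡ k ≡ s × inWindow N d x (toℕ a) ≡ true × M* a t ≡ true
    window-part-true {x} e with extend-true k {window-part x} e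
    ... | a , a↑≡s , e′ = a , a↑≡s , ∧-true {inWindow N d x (toℕ a)} e′

    window-part-isMatching : ∀ x → IsMatchingOfWindow (adjExt k adj) d x (extend k (window-part x))
    window-part-isMatching x = in-window , one-per-node , one-per-target
      where
      E : EdgeSet N m
      E = extend k (window-part x)
      in-window : ∀ s t → E s t ≡ true → adjExt k adj s t ≡ true × InWindow N d x s
      in-window s t e with window-part-true {x} e
      ... | a , refl , inW , M*at =
        trans ([,]-splitAt-↑ˡ (λ a → adj a t) _ a) (proj₁ M*-dist a t M*at) ,
        inWindow-sound (a ↑ˡ k) (subst (λ z → inWindow N d x z ≡ true) (sym (toℕ-↑ˡ a k)) inW)
      one-per-node : ∀ s t t′ → E s t ≡ true → E s t′ ≡ true → t ≡ t′
      one-per-node s t t′ e e′ with window-part-true {x} e | window-part-true {x} e′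
      ... | a , refl , _ , M*at | a′ , a′↑≡a↑ , _ , M*a′t′ with ↑ˡ-injective k a′ a a′↑≡a↑
      ...   | refl = proj₁ (proj₂ M*-dist) a t t′ M*at M*a′t′
      one-per-target : ∀ s s′ t → E s t ≡ true → E s′ t ≡ true → s ≡ s′
      one-per-target s s′ t e e′ with window-part-true {x} e | window-part-true {x} e′
      ... | a , refl , inW , M*at | a′ , refl , inW′ , M*a′t with a Fin.≟ a′
      ...   | yes refl = refl
      ...   | no a≢a′  = ⊥-elim (ℕ.<⇒≱
        (inWindow-close {n} {N} {d′} {x} (ℕ.+-monoʳ-≤ n d′≤k) (toℕ<n a) (toℕ<n a′) inW inW′)
        (proj₂ (proj₂ M*-dist) a a′ t M*at M*a′t a≢a′))

    wt-window-part : ∀ x →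
                     wt w (window-part x) ≡ ∑[ a < n ] (if inWindow N d x (toℕ a) then wt-at w M* a else 0ℚ)
    wt-window-part x = trans (wt≡∑wt-at w (window-part x))
      (sum-cong-≗ {n} (λ a → ∑-if-∧ (inWindow N d x (toℕ a)) (M* a) (w a)))

    ∑-wt-window-part : ∑[ x < N ] wt w (window-part (toℕ x)) ≡ d · wt w M*
    ∑-wt-window-part = begin
      ∑[ x < N ] wt w (window-part (toℕ x))
        ≡⟨ sum-cong-≗ {N} (wt-window-part ∘ toℕ) ⟩
      ∑[ x < N ] ∑[ a < n ] (if inWindow N d (toℕ x) (toℕ a) then wt-at w M* a else 0ℚ)
        ≡⟨ ∑-comm {N} {n} (λ x a → if inWindow N d (toℕ x) (toℕ a) then wt-at w M* a else 0ℚ) ⟩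
      ∑[ a < n ] ∑[ x < N ] (if inWindow N d (toℕ x) (toℕ a) then wt-at w M* a else 0ℚ)
        ≡⟨ sum-cong-≗ {n} (λ a → ∑-inWindow (wt-at w M* a) (d≤N a) (a<N a)) ⟩
      ∑[ a < n ] (d · wt-at w M* a)
        ≡⟨ sum-cong-≗ {n} (λ a → sum-replicate d {wt-at w M* a}) ⟨
      ∑[ a < n ] ∑[ _ < d ] wt-at w M* a
        ≡⟨ ∑-comm {n} {d} (λ a _ → wt-at w M* a) ⟩
      ∑[ _ < d ] ∑[ a < n ] wt-at w M* a
        ≡⟨ sum-replicate d {∑[ a < n ] wt-at w M* a} ⟩
      d · ∑[ a < n ] wt-at w M* a
        ≡⟨ cong (d ·_) (wt≡∑wt-at w M*) ⟨
      d · wt w M*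
        ∎
      where
      open ≡-Reasoning
      d≤N : Fin n → d ≤ N
      d≤N a = ℕ.≤-trans (s≤s (ℕ.m≤n+m d′ (toℕ a))) (ℕ.+-mono-≤ (toℕ<n a) d′≤k)
      a<N : (a : Fin n) → toℕ a < N
      a<N a = ℕ.<-≤-trans (toℕ<n a) (ℕ.m≤m+n n k)

    d·wt-M*≤∑wt-M : d · wt w M* ≤ℚ ∑[ i < D ] wt w (M (toℕ i))
    d·wt-M*≤∑wt-M = begin
      d · wt w M*
        ≡⟨ ∑-wt-window-part ⟨
      ∑[ x < N ] wt w (window-part (toℕ x))
        ≡⟨ sum-cong-≗ {N} (λ x → wt-extend k w (window-part (toℕ x))) ⟨
      ∑[ x < N ] wt (wExt k w) (extend k (window-part (toℕ x)))
        ≤⟨ ∑-mono-≤ (λ x → F-optimal (toℕ<n x) (window-part-isMatching (toℕ x))) ⟩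
      ∑[ x < N ] wt (wExt k w) (F (toℕ x))
        ≡⟨ cong (λ N → ∑[ x < N ] wt (wExt k w) (F (toℕ x))) n+k≡q*D ⟩
      ∑[ x < q * D ] wt (wExt k w) (F (toℕ x))
        ≡⟨ ∑-blocks q D (wt (wExt k w) ∘ F) ⟩
      ∑[ i < D ] ∑[ j < q ] wt (wExt k w) (F (toℕ i + toℕ j * D))
        ≡⟨ sum-cong-≗ {D} (λ i → wt-M (toℕ<n i)) ⟨
      ∑[ i < D ] wt w (M (toℕ i))
        ∎
      where open ℚ.≤-Reasoning

theorem7 : (n m : ℕ) (adj : Adj n m) (w : Weight n m)
  → (∀ s t → adj s t ≡ true → 0ℚ ≤ℚ w s t)
  → (d : ℕ) .{{_ : NonZero d}}
  → (k : ℕ) → d ∸ 1 ≤ k → k ≤ 3 * d ∸ 3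
  → (div : (2 * d ∸ 1) ∣ (n + k))
  → (F : ℕ → EdgeSet (n + k) m)
  → (∀ j → j < n + k → IsMaxWeightMatchingOfWindow (adjExt k adj) (wExt k w) d j (F j))
  → (istar : Fin (2 * d ∸ 1))
  → (∀ (i : Fin (2 * d ∸ 1)) → wt w (unionM k d (_∣_.quotient div) F (toℕ i))
                                 ≤ℚ wt w (unionM k d (_∣_.quotient div) F (toℕ istar)))
  → IsDDistanceMatching d adj (unionM k d (_∣_.quotient div) F (toℕ istar))
    × (∀ Mstar → IsDDistanceMatching d adj Mstar
       → wt w Mstar ≤ℚ ((1ℚ +ℚ 1ℚ) - (+ 1 / d)) *ℚ wt w (unionM k d (_∣_.quotient div) F (toℕ istar)))
theorem7 n m adj w _ (suc d′) k d′≤k _ div F F-max i* i*-max =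
  M-isDDistanceMatching (toℕ<n i*) , λ M* M*-dist → d·x≤[2d-1]·y⇒x≤[2-1/d]*y d′ (begin
    d · wt w M*                    ≤⟨ d·wt-M*≤∑wt-M M* M*-dist ⟩
    ∑[ i < D ] wt w (M (toℕ i))    ≤⟨ ∑-mono-≤ i*-max ⟩
    ∑[ _ < D ] wt w (M (toℕ i*))   ≡⟨ sum-replicate D {wt w (M (toℕ i*))} ⟩
    D · wt w (M (toℕ i*))          ≡⟨ cong (_· wt w (M (toℕ i*))) D≡d+d′ ⟩
    (d + d′) · wt w (M (toℕ i*))   ∎)
  where
  open Approximation adj w d′ k (_∣_.quotient div) d′≤k (_∣_.equality div) F F-max
  open ℚ.≤-Reasoning
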